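{- Let $a,k$ be positive integers and $n\ge0$, $m\ge1$ integers. Then $$c_{n,m}(a^k)=\begin{cases} c_{n,m}(1) & \text{if } a\le m,\\ \delta_{n,0} & \text{if } a>m.\end{cases}$$
   Context: $a^k$ is the word of $k$ copies of $a$. For a word $u$ over the positive integers, $c_{n,m}(u)$ is the number of words $w\in\{1,\ldots,m\}^n$ such that $uw\equiv wu$, where $\equiv$ is Knuth equivalence (equivalently, $P(uw)=P(wu)$ for RSK insertion tableaux). $\delta_{n,0}$ is $1$ if $n=0$ and $0$ otherwise. -}

module Defs where

open import Data.Nat using (ℕ; zero; suc; _<ᵇ_)
open import Data.Bool using (if_then_else_)
open import Data.Maybe using (Maybe; just; nothing)
open import Data.Product using (_×_; _,_)
open import Data.List using (List; []; _∷_; _++_; map; concatMap; foldl; length; filter; upTo)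
open import Data.List.Properties using (≡-dec)
import Data.Nat as ℕ
open import Relation.Binary.PropositionalEquality using (_≡_)
open import Relation.Nullary using (Dec)

-- Words over the positive integers are lists of naturals (letters ≥ 1).
Word : Set
Word = List ℕ

-- A tableau is the list of its rows (top row first).
Tableau : Set
Tableau = List (List ℕ)

rowInsert : ℕ → List ℕ → List ℕ × Maybe ℕ
rowInsert x [] = x ∷ [] , nothing
rowInsert x (y ∷ ys) with x <ᵇ y
... | Data.Bool.true = x ∷ ys , just y
... | Data.Bool.false with rowInsert x ys
...   | ys' , b = y ∷ ys' , b

insert : ℕ → Tableau → Tableau
insert x [] = (x ∷ []) ∷ []
insert x (r ∷ rs) with rowInsert x r
... | r' , nothing = r' ∷ rs
... | r' , just y = r' ∷ insert y rs

P : Word → Tableau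
P w = foldl (λ t x → insert x t) [] w

-- Knuth equivalence, via the insertion tableau:  u ≡ᴷ v  iff  P(u) = P(v).
_≡ᴷ_ : Word → Word → Set
u ≡ᴷ v = P u ≡ P v

_≡ᴷ?_ : (u v : Word) → Dec (u ≡ᴷ v)
u ≡ᴷ? v = ≡-dec (≡-dec ℕ._≟_) (P u) (P v)

letters : ℕ → List ℕ
letters m = map suc (upTo m)

words : ℕ → ℕ → List Word
words zero m = [] ∷ []
words (suc n) m = concatMap (λ w → map (λ i → i ∷ w) (letters m)) (words n m)

c : ℕ → ℕ → Word → ℕ
c n m u = length (filter (λ w → (u ++ w) ≡ᴷ? (w ++ u)) (words n m))

δ₀ : ℕ → ℕ
δ₀ zero = 1
δ₀ (suc n) = 0

{-# OPTIONS --safe #-}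
module Submission where

-- Write the first row of P(w) as L aᶜ H with L < a < H.  Inserting w into the row aᵏ runs exactly
-- like inserting it into the empty row, with k extra copies of a, until some letter below a finds
-- no copy of a to bump (a miss); after a miss the extra copies are never fully recovered.  The first
-- row of P(w aᵏ) is L aᶜ⁺ᵏ with the first k entries of H removed, and its lower rows receive those k
-- entries.  Hence aᵏ w ≡ w aᵏ iff there is no miss and H is empty, i.e. iff the first row of P(w) is
-- no longer than the number of a's in w; by Schensted's theorem, iff no weakly increasing subsequence
-- of w is longer than its subsequence of a's ("w is a-dominated").
--
-- For a > m only the empty word is a-dominated.  For a < m, read a + 1 as an opening and a as a
-- closing bracket and raise every unmatched a to a + 1: on a-dominated words every a + 1 is matched,
-- which makes this map injective, and it maps them to (a+1)-dominated words.  Reverse complement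
-- x ↦ m + 1 − x maps m-dominated words injectively to 1-dominated ones.  So the numbers of
-- a-dominated words in {1,…,m}ⁿ are the same for all 1 ≤ a ≤ m.

open import Defs
open import Data.Bool using (Bool; true; false; if_then_else_)
open import Data.Empty using (⊥-elim)
open import Data.List using (List; []; _∷_; _++_; [_]; length; foldl; replicate; drop; take; head; fromMaybe; filter; map; reverse)
open import Data.List.Extrema.Nat using (max; xs≤max)
open import Data.List.Membership.Propositional using (_∈_; find; lose)
open import Data.List.Membership.Propositional.Properties
  using (∈-∃++; ∈-++⁻; ∈-++⁺ˡ; ∈-++⁺ʳ; ∈-map⁻; ∈-map⁺; ∈-filter⁻; ∈-filter⁺; ∈-concatMap⁻; ∈-concatMap⁺; ∈-upTo⁻; ∈-upTo⁺)
open import Data.List.Properties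
  using ( ++-assoc; ++-identityʳ; ++-cancelˡ; ∷-injectiveˡ; ∷-injectiveʳ; length-++; length-drop; length-replicate
        ; length-reverse; length-map; length-filter; drop-[]; take-[]; unfold-reverse; reverse-map; reverse-involutive
        ; map-∘; map-id-local; filter-++; filter-accept; filter-reject; filter-all; filter-none; filter-≐)
open import Data.List.Relation.Binary.Disjoint.Propositional using (Disjoint)
open import Data.List.Relation.Binary.Permutation.Propositional using (↭-sym)
open import Data.List.Relation.Binary.Permutation.Propositional.Properties using (All-resp-↭; ↭-reverse; ↭-length; filter-↭)
open import Data.List.Relation.Binary.Sublist.Propositional using (_⊆_; []; _∷_; _∷ʳ_; minimum)
import Data.List.Relation.Binary.Sublist.Propositional.Properties as Sublist
open import Data.List.Relation.Unary.All as All using (All; []; _∷_)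
import Data.List.Relation.Unary.All.Properties as All
open import Data.List.Relation.Unary.AllPairs as AllPairs using (AllPairs; []; _∷_)
import Data.List.Relation.Unary.AllPairs.Properties as AllPairs
open import Data.List.Relation.Unary.Any using (here; there)
open import Data.List.Relation.Unary.Unique.Propositional using (Unique)
import Data.List.Relation.Unary.Unique.Propositional.Properties as Unique
open import Data.Maybe using (Maybe; just; nothing)
open import Data.Nat using (ℕ; zero; suc; pred; _+_; _∸_; _≤_; _<_; _≤′_; ≤′-refl; ≤′-step; z≤n; s≤s; z<s; _<ᵇ_; _≟_; _≤?_; _<?_)
open import Data.Nat.Properties
open import Data.Nat.Tactic.RingSolver using (solve-∀)
open import Data.Product using (_×_; _,_; proj₁; proj₂; ∃-syntax)
open import Data.Sum as Sum using (_⊎_; inj₁; inj₂)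
open import Function using (case_of_; _∘_; flip)
open import Function.Bundles using (_⇔_; mk⇔; Equivalence)
open import Level using (0ℓ)
open import Relation.Binary.Definitions using (tri<; tri≈; tri>)
open import Relation.Binary.PropositionalEquality
  using (_≡_; _≢_; refl; sym; trans; cong; cong₂; subst; subst₂; ≢-sym; module ≡-Reasoning)
open import Relation.Nullary using (¬_; yes; no)
import Relation.Nullary.Decidable as Dec
open import Relation.Nullary.Reflects using (ofʸ; ofⁿ)
open import Relation.Unary using (Pred; Decidable)

replicate-++-∷ : ∀ c (a : ℕ) X → replicate c a ++ a ∷ X ≡ a ∷ replicate c a ++ X
replicate-++-∷ zero    a X = refl
replicate-++-∷ (suc c) a X = cong (a ∷_) (replicate-++-∷ c a X)

≡drop-suc⇒[] : ∀ k (xs : List ℕ) → xs ≡ drop (suc k) xs → xs ≡ []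
≡drop-suc⇒[] k []       _  = refl
≡drop-suc⇒[] k (x ∷ xs) eq = ⊥-elim (<-irrefl refl (begin
  suc (length xs)      ≡⟨ cong length eq ⟩
  length (drop k xs)   ≡⟨ length-drop k xs ⟩
  length xs ∸ k        ≤⟨ m∸n≤m (length xs) k ⟩
  length xs            ∎))
  where open ≤-Reasoning

length≡0⇒[] : ∀ (xs : List ℕ) → length xs ≡ 0 → xs ≡ []
length≡0⇒[] [] _ = refl

m+n+o≤m⇒n≡0×o≡0 : ∀ m n o → m + n + o ≤ m → n ≡ 0 × o ≡ 0
m+n+o≤m⇒n≡0×o≡0 m n o le = m+n≡0⇒m≡0 n n+o≡0 , m+n≡0⇒n≡0 n n+o≡0
  where
  n+o≡0 : n + o ≡ 0
  n+o≡0 = n≤0⇒n≡0 (+-cancelˡ-≤ m (n + o) 0 (begin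
    m + (n + o) ≡⟨ sym (+-assoc m n o) ⟩
    m + n + o   ≤⟨ le ⟩
    m           ≡⟨ sym (+-identityʳ m) ⟩
    m + 0       ∎))
    where open ≤-Reasoning

All-reverse : ∀ {P : ℕ → Set} {xs} → All P xs → All P (reverse xs)
All-reverse {xs = xs} = All-resp-↭ (↭-sym (↭-reverse xs))

AllPairs-reverse : ∀ {R : ℕ → ℕ → Set} {xs} → AllPairs R xs → AllPairs (flip R) (reverse xs)
AllPairs-reverse [] = []
AllPairs-reverse {xs = x ∷ xs} (Rx ∷ pairs) rewrite unfold-reverse x xs =
  AllPairs.++⁺ (AllPairs-reverse pairs) ([] ∷ []) (All.map (_∷ []) (All-reverse Rx))

module _ {A : Set} where

  unique-⊆⇒length≤ : ∀ {xs ys : List A} → Unique xs → (∀ {z} → z ∈ xs → z ∈ ys) → length xs ≤ length ys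
  unique-⊆⇒length≤ {[]}     _              _   = z≤n
  unique-⊆⇒length≤ {x ∷ xs} (x∉xs ∷ unique) xs⊆ys with ∈-∃++ (xs⊆ys (here refl))
  ... | ys₁ , ys₂ , refl = begin
    suc (length xs)              ≤⟨ s≤s (unique-⊆⇒length≤ unique xs⊆ys₁++ys₂) ⟩
    suc (length (ys₁ ++ ys₂))    ≡⟨ cong suc (length-++ ys₁) ⟩
    suc (length ys₁ + length ys₂) ≡⟨ sym (+-suc (length ys₁) (length ys₂)) ⟩
    length ys₁ + length (x ∷ ys₂) ≡⟨ sym (length-++ ys₁) ⟩
    length (ys₁ ++ x ∷ ys₂)      ∎
    where
    open ≤-Reasoning
    xs⊆ys₁++ys₂ : ∀ {z} → z ∈ xs → z ∈ ys₁ ++ ys₂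
    xs⊆ys₁++ys₂ z∈xs with ∈-++⁻ ys₁ (xs⊆ys (there z∈xs))
    ... | inj₁ z∈ys₁         = ∈-++⁺ˡ z∈ys₁
    ... | inj₂ (here refl)   = ⊥-elim (All.lookup x∉xs z∈xs refl)
    ... | inj₂ (there z∈ys₂) = ∈-++⁺ʳ ys₁ z∈ys₂

  map-unique : ∀ (f : A → A) {xs} → Unique xs → (∀ {x y} → x ∈ xs → y ∈ xs → f x ≡ f y → x ≡ y) →
    Unique (map f xs)
  map-unique f {[]}     []               _   = []
  map-unique f {x ∷ xs} (x∉xs ∷ unique) inj =
    All.map⁺ (All.tabulate (λ y∈xs fx≡fy → All.lookup x∉xs y∈xs (inj (here refl) (there y∈xs) fx≡fy)))
    ∷ map-unique f unique (λ x∈ y∈ → inj (there x∈) (there y∈))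

  filter-length-≤ : ∀ {P Q : Pred A 0ℓ} (P? : Decidable P) (Q? : Decidable Q) {xs} → Unique xs → (f : A → A) →
    (∀ {x} → x ∈ xs → P x → f x ∈ xs × Q (f x)) →
    (∀ {x y} → x ∈ xs → y ∈ xs → P x → P y → f x ≡ f y → x ≡ y) →
    length (filter P? xs) ≤ length (filter Q? xs)
  filter-length-≤ P? Q? {xs} unique f into inj = begin
    length (filter P? xs)          ≡⟨ sym (length-map f (filter P? xs)) ⟩
    length (map f (filter P? xs))  ≤⟨ unique-⊆⇒length≤ (map-unique f (Unique.filter⁺ P? unique) inj-filtered) image⊆ ⟩
    length (filter Q? xs)          ∎
    where
    open ≤-Reasoning
    inj-filtered : ∀ {x y} → x ∈ filter P? xs → y ∈ filter P? xs → f x ≡ f y → x ≡ y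
    inj-filtered x∈ y∈ = let x∈xs , px = ∈-filter⁻ P? x∈ ; y∈xs , py = ∈-filter⁻ P? y∈ in inj x∈xs y∈xs px py
    image⊆ : ∀ {z} → z ∈ map f (filter P? xs) → z ∈ filter Q? xs
    image⊆ z∈ with ∈-map⁻ f z∈
    ... | x , x∈ , refl = let x∈xs , px = ∈-filter⁻ P? x∈ ; fx∈xs , qfx = into x∈xs px in ∈-filter⁺ Q? fx∈xs qfx

count : ℕ → Word → ℕ
count a w = length (filter (_≟ a) w)

count-++ : ∀ a u v → count a (u ++ v) ≡ count a u + count a v
count-++ a u v = trans (cong length (filter-++ (_≟ a) u v)) (length-++ (filter (_≟ a) u))

count-∷-≡ : ∀ a w → count a (a ∷ w) ≡ suc (count a w)
count-∷-≡ a w = cong length (filter-accept (_≟ a) {xs = w} refl)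

count-∷-≢ : ∀ {a x} w → x ≢ a → count a (x ∷ w) ≡ count a w
count-∷-≢ {a} w x≢a = cong length (filter-reject (_≟ a) {xs = w} x≢a)

count≤ : ℕ → List ℕ → ℕ
count≤ c r = length (filter (_≤? c) r)

count≤-∷-≤ : ∀ {c y} r → y ≤ c → count≤ c (y ∷ r) ≡ suc (count≤ c r)
count≤-∷-≤ {c} r y≤c = cong length (filter-accept (_≤? c) {xs = r} y≤c)

count≤-∷-> : ∀ {c y} r → c < y → count≤ c (y ∷ r) ≡ count≤ c r
count≤-∷-> {c} r c<y = cong length (filter-reject (_≤? c) {xs = r} (<⇒≱ c<y))

count≤-none : ∀ {c} r → All (c <_) r → count≤ c r ≡ 0
count≤-none {c} r c<r = cong length (filter-none (_≤? c) (All.map <⇒≱ c<r))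

count≤-∷ : ∀ {c} y r → count≤ c r ≤ count≤ c (y ∷ r)
count≤-∷ {c} y r with y ≤? c
... | yes y≤c rewrite count≤-∷-≤ r y≤c = n≤1+n _
... | no y≰c rewrite count≤-∷-> r (≰⇒> y≰c) = ≤-refl

count≤-mono : ∀ {c d} r → c ≤ d → count≤ c r ≤ count≤ d r
count≤-mono [] _ = z≤n
count≤-mono {c} {d} (y ∷ r) c≤d with y ≤? c
... | yes y≤c rewrite count≤-∷-≤ r y≤c | count≤-∷-≤ r (≤-trans y≤c c≤d) = s≤s (count≤-mono r c≤d)
... | no y≰c rewrite count≤-∷-> r (≰⇒> y≰c) = ≤-trans (count≤-mono r c≤d) (count≤-∷ y r)

Increasing : List ℕ → Set
Increasing = AllPairs _≤_

record LongIncreasing (lo n : ℕ) (w : Word) : Set where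
  constructor long
  field
    {seq}      : List ℕ
    seq⊆w      : seq ⊆ w
    increasing : Increasing seq
    lo≤seq     : All (lo ≤_) seq
    n≤length   : n ≤ length seq

skip : ∀ {lo n w} x → LongIncreasing lo n w → LongIncreasing lo n (x ∷ w)
skip x (long τ inc lo≤ n≤) = long (x ∷ʳ τ) inc lo≤ n≤

prepend : ∀ {lo lo′ n w x} → lo′ ≤ x → x ≤ lo → LongIncreasing lo n w → LongIncreasing lo′ (suc n) (x ∷ w)
prepend lo′≤x x≤lo (long τ inc lo≤ n≤) =
  long (refl ∷ τ) (All.map (≤-trans x≤lo) lo≤ ∷ inc) (lo′≤x ∷ All.map (≤-trans lo′≤x ∘ ≤-trans x≤lo) lo≤) (s≤s n≤)

weaken : ∀ {lo lo′ n n′ w} → lo′ ≤ lo → n′ ≤ n → LongIncreasing lo n w → LongIncreasing lo′ n′ w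
weaken lo′≤lo n′≤n (long τ inc lo≤ n≤) = long τ inc (All.map (≤-trans lo′≤lo) lo≤) (≤-trans n′≤n n≤)

occurrences-increasing : ∀ c w → LongIncreasing c (count c w) w
occurrences-increasing c w = long (Sublist.filter-⊆ (_≟ c) w) (constant all≡c) (All.map (≤-reflexive ∘ sym) all≡c) ≤-refl
  where
  all≡c : All (_≡ c) (filter (_≟ c) w)
  all≡c = All.all-filter (_≟ c) w
  constant : ∀ {xs} → All (_≡ c) xs → Increasing xs
  constant [] = []
  constant (refl ∷ xs≡c) = All.map (≤-reflexive ∘ sym) xs≡c ∷ constant xs≡c

insertAll : Tableau → Word → Tableau
insertAll = foldl (λ t x → insert x t)

rowInserts : List ℕ → Word → List ℕ
rowInserts r [] = r
rowInserts r (x ∷ w) = rowInserts (proj₁ (rowInsert x r)) w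

rowBumps : List ℕ → Word → Word
rowBumps r [] = []
rowBumps r (x ∷ w) = fromMaybe (proj₂ (rowInsert x r)) ++ rowBumps (proj₁ (rowInsert x r)) w

firstRow : Word → List ℕ
firstRow = rowInserts []

insertAll-∷ : ∀ r rs w → insertAll (r ∷ rs) w ≡ rowInserts r w ∷ insertAll rs (rowBumps r w)
insertAll-∷ r rs [] = refl
insertAll-∷ r rs (x ∷ w) with rowInsert x r
... | r′ , nothing = insertAll-∷ r′ rs w
... | r′ , just y  = insertAll-∷ r′ (insert y rs) w

P-∷ : ∀ x w → P (x ∷ w) ≡ firstRow (x ∷ w) ∷ P (rowBumps [] (x ∷ w))
P-∷ x w = insertAll-∷ (x ∷ []) [] w

P-++-∷ : ∀ u x v → P (u ++ x ∷ v) ≡ firstRow (u ++ x ∷ v) ∷ P (rowBumps [] (u ++ x ∷ v))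
P-++-∷ []      x v = P-∷ x v
P-++-∷ (y ∷ u) x v = P-∷ y (u ++ x ∷ v)

rowInserts-++ : ∀ r u v → rowInserts r (u ++ v) ≡ rowInserts (rowInserts r u) v
rowInserts-++ r []      v = refl
rowInserts-++ r (x ∷ u) v = rowInserts-++ _ u v

rowBumps-++ : ∀ r u v → rowBumps r (u ++ v) ≡ rowBumps r u ++ rowBumps (rowInserts r u) v
rowBumps-++ r []      v = refl
rowBumps-++ r (x ∷ u) v = trans (cong (b ++_) (rowBumps-++ _ u v)) (sym (++-assoc b _ _))
  where
  b : Word
  b = fromMaybe (proj₂ (rowInsert x r))

rowInsert-appends : ∀ {x} r → All (_≤ x) r → rowInsert x r ≡ (r ++ [ x ] , nothing)
rowInsert-appends [] [] = refl
rowInsert-appends {x} (y ∷ r) (y≤x ∷ r≤x) with x <ᵇ y | <ᵇ-reflects-< x y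
... | true  | ofʸ x<y = ⊥-elim (<⇒≱ x<y y≤x)
... | false | _ rewrite rowInsert-appends r r≤x = refl

rowInsert-nothing⇒All≤ : ∀ {x} r {r′} → rowInsert x r ≡ (r′ , nothing) → All (_≤ x) r
rowInsert-nothing⇒All≤ [] _ = []
rowInsert-nothing⇒All≤ {x} (y ∷ r) eq with x <ᵇ y | <ᵇ-reflects-< x y
... | true  | _ = case eq of λ ()
... | false | ofⁿ x≮y with rowInsert x r in e
...   | _ , nothing = ≮⇒≥ x≮y ∷ rowInsert-nothing⇒All≤ r e
...   | _ , just _  = case eq of λ ()

rowInsert-< : ∀ {x} r → All (x <_) r → rowInsert x r ≡ (x ∷ drop 1 r , head r)
rowInsert-< [] [] = refl
rowInsert-< {x} (y ∷ r) (x<y ∷ _) with x <ᵇ y | <ᵇ-reflects-< x y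
... | true  | _ = refl
... | false | ofⁿ x≮y = ⊥-elim (x≮y x<y)

rowInsert-++-≤ : ∀ {x} L M → All (_≤ x) L →
  rowInsert x (L ++ M) ≡ (L ++ proj₁ (rowInsert x M) , proj₂ (rowInsert x M))
rowInsert-++-≤ [] M [] = refl
rowInsert-++-≤ {x} (y ∷ L) M (y≤x ∷ L≤x) with x <ᵇ y | <ᵇ-reflects-< x y
... | true  | ofʸ x<y = ⊥-elim (<⇒≱ x<y y≤x)
... | false | _ rewrite rowInsert-++-≤ L M L≤x = refl

rowInsert-++-bump : ∀ {x y} L M {L′} → rowInsert x L ≡ (L′ , just y) → rowInsert x (L ++ M) ≡ (L′ ++ M , just y)
rowInsert-++-bump [] M ()
rowInsert-++-bump {x} (z ∷ L) M eq with x <ᵇ z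
rowInsert-++-bump {x} (z ∷ L) M refl | true = refl
... | false with rowInsert x L in e
...   | _ , nothing = case eq of λ ()
rowInsert-++-bump {x} (z ∷ L) M refl | false | _ , just _ rewrite rowInsert-++-bump L M e = refl

rowInsert-bump-length : ∀ {x y} L {L′} → rowInsert x L ≡ (L′ , just y) → length L′ ≡ length L
rowInsert-bump-length [] ()
rowInsert-bump-length {x} (z ∷ L) eq with x <ᵇ z
rowInsert-bump-length {x} (z ∷ L) refl | true = refl
... | false with rowInsert x L in e
...   | _ , nothing = case eq of λ ()
rowInsert-bump-length {x} (z ∷ L) refl | false | _ , just _ = cong suc (rowInsert-bump-length L e)

rowInsert-All : ∀ {P : ℕ → Set} {x} r → P x → All P r →
  All P (proj₁ (rowInsert x r)) × All P (fromMaybe (proj₂ (rowInsert x r)))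
rowInsert-All [] px [] = px ∷ [] , []
rowInsert-All {x = x} (y ∷ r) px (py ∷ pr) with x <ᵇ y
... | true = px ∷ pr , py ∷ []
... | false with rowInsert x r | rowInsert-All r px pr
...   | _ , _ | pr′ , pb = py ∷ pr′ , pb

rowInserts-All : ∀ {P : ℕ → Set} r w → All P r → All P w → All P (rowInserts r w)
rowInserts-All r [] pr _ = pr
rowInserts-All r (x ∷ w) pr (px ∷ pw) = rowInserts-All _ w (proj₁ (rowInsert-All r px pr)) pw

rowInsert-increasing : ∀ {x} r → Increasing r → Increasing (proj₁ (rowInsert x r))
rowInsert-increasing [] [] = [] ∷ []
rowInsert-increasing {x} (y ∷ r) (y≤r ∷ inc) with x <ᵇ y | <ᵇ-reflects-< x y
... | true  | ofʸ x<y = All.map (≤-trans (<⇒≤ x<y)) y≤r ∷ inc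
... | false | ofⁿ x≮y with rowInsert x r | rowInsert-increasing {x} r inc | rowInsert-All {P = y ≤_} r (≮⇒≥ x≮y) y≤r
...   | _ , _ | inc′ | y≤r′ , _ = y≤r′ ∷ inc′

-- The first row around a letter a

module AroundLetter (a : ℕ) where

  record Split : Set where
    constructor ⟨_,_,_⟩
    field
      below  : List ℕ
      copies : ℕ
      above  : List ℕ
  open Split public

  join : Split → List ℕ
  join ⟨ L , c , H ⟩ = L ++ replicate c a ++ H

  Separated : Split → Set
  Separated ⟨ L , c , H ⟩ = All (_< a) L × All (a <_) H

  weight : Split → ℕ
  weight t = length (below t) + copies t

  record Step : Set where
    constructor step
    field
      next   : Split
      bump   : Maybe ℕ
      missed : Bool
  open Step public

  missCount : Step → ℕ
  missCount s = if missed s then 1 else 0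

  -- A letter below a has just been appended to the part below a: it bumps the first copy of a or,
  -- if there is none, the first entry above a (a miss).
  enterBelow : List ℕ → ℕ → List ℕ → Step
  enterBelow L zero    H = step ⟨ L , 0 , drop 1 H ⟩ (head H) true
  enterBelow L (suc c) H = step ⟨ L , c , H ⟩ (just a) false

  stepAt : ℕ → Split → Step
  stepAt x ⟨ L , c , H ⟩ with <-cmp x a
  ... | tri< _ _ _ with rowInsert x L
  ...   | L′ , just y  = step ⟨ L′ , c , H ⟩ (just y) false
  ...   | L′ , nothing = enterBelow L′ c H
  stepAt x ⟨ L , c , H ⟩ | tri≈ _ _ _ = step ⟨ L , suc c , drop 1 H ⟩ (head H) false
  stepAt x ⟨ L , c , H ⟩ | tri> _ _ _ = step ⟨ L , c , proj₁ (rowInsert x H) ⟩ (proj₂ (rowInsert x H)) false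

  rowInsert-enterBelow : ∀ L c H →
    (join (next (enterBelow L c H)) , bump (enterBelow L c H))
      ≡ (L ++ drop 1 (replicate c a ++ H) , head (replicate c a ++ H))
  rowInsert-enterBelow L zero    H = refl
  rowInsert-enterBelow L (suc c) H = refl

  rowInsert-join : ∀ x t → Separated t → rowInsert x (join t) ≡ (join (next (stepAt x t)) , bump (stepAt x t))
  rowInsert-join x ⟨ L , c , H ⟩ (L<a , a<H) with <-cmp x a
  ... | tri< x<a _ _ with rowInsert x L in e
  ...   | L′ , just y = rowInsert-++-bump L (replicate c a ++ H) e
  ...   | L′ , nothing with refl ← trans (sym e) (rowInsert-appends L (rowInsert-nothing⇒All≤ L e)) = begin
    rowInsert x (L ++ M)                             ≡⟨ rowInsert-++-≤ L M (rowInsert-nothing⇒All≤ L e) ⟩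
    (L ++ proj₁ (rowInsert x M) , proj₂ (rowInsert x M)) ≡⟨ cong (λ p → (L ++ proj₁ p , proj₂ p)) (rowInsert-< M x<M) ⟩
    (L ++ x ∷ drop 1 M , head M)                     ≡⟨ cong (_, head M) (sym (++-assoc L [ x ] (drop 1 M))) ⟩
    ((L ++ [ x ]) ++ drop 1 M , head M)              ≡⟨ sym (rowInsert-enterBelow (L ++ [ x ]) c H) ⟩
    (join (next (enterBelow L′ c H)) , bump (enterBelow L′ c H)) ∎
    where
    open ≡-Reasoning
    M : List ℕ
    M = replicate c a ++ H
    x<M : All (x <_) M
    x<M = All.++⁺ (All.replicate⁺ c x<a) (All.map (<-trans x<a) a<H)
  rowInsert-join x ⟨ L , c , H ⟩ (L<a , a<H) | tri≈ _ refl _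
    rewrite rowInsert-++-≤ L (replicate c x ++ H) (All.map <⇒≤ L<a)
          | rowInsert-++-≤ (replicate c x) H (All.replicate⁺ c ≤-refl)
          | rowInsert-< H a<H
          = cong (λ z → (L ++ z , head H)) (replicate-++-∷ c x (drop 1 H))
  rowInsert-join x ⟨ L , c , H ⟩ (L<a , a<H) | tri> _ _ a<x
    rewrite rowInsert-++-≤ L (replicate c a ++ H) (All.map (λ y<a → <⇒≤ (<-trans y<a a<x)) L<a)
          | rowInsert-++-≤ (replicate c a) H (All.replicate⁺ c (<⇒≤ a<x))
          = refl

  separated-enterBelow : ∀ L c H → All (_< a) L → All (a <_) H → Separated (next (enterBelow L c H))
  separated-enterBelow L zero    H L<a a<H = L<a , All.drop⁺ 1 a<H
  separated-enterBelow L (suc c) H L<a a<H = L<a , a<H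

  separated-stepAt : ∀ x t → Separated t → Separated (next (stepAt x t))
  separated-stepAt x ⟨ L , c , H ⟩ (L<a , a<H) with <-cmp x a
  ... | tri< x<a _ _ with rowInsert x L | rowInsert-All L x<a L<a
  ...   | L′ , just y  | L′<a , _ = L′<a , a<H
  ...   | L′ , nothing | L′<a , _ = separated-enterBelow L′ c H L′<a a<H
  separated-stepAt x ⟨ L , c , H ⟩ (L<a , a<H) | tri≈ _ _ _   = L<a , All.drop⁺ 1 a<H
  separated-stepAt x ⟨ L , c , H ⟩ (L<a , a<H) | tri> _ _ a<x = L<a , proj₁ (rowInsert-All H a<x a<H)

  weight-enterBelow : ∀ L x c H →
    weight (next (enterBelow (L ++ [ x ]) c H)) ≡ missCount (enterBelow (L ++ [ x ]) c H) + (length L + c)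
  weight-enterBelow L x zero H rewrite length-++ L {[ x ]} | +-identityʳ (length L + 1) | +-identityʳ (length L) = +-comm (length L) 1
  weight-enterBelow L x (suc c) H rewrite length-++ L {[ x ]} = +-assoc (length L) 1 c

  weight-stepAt : ∀ x t → weight (next (stepAt x t)) ≡ count a [ x ] + missCount (stepAt x t) + weight t
  weight-stepAt x ⟨ L , c , H ⟩ with <-cmp x a
  ... | tri< x<a _ _ rewrite count-∷-≢ [] (<⇒≢ x<a) with rowInsert x L in e
  ...   | L′ , just y rewrite rowInsert-bump-length L e = refl
  ...   | L′ , nothing with refl ← trans (sym e) (rowInsert-appends L (rowInsert-nothing⇒All≤ L e)) = weight-enterBelow L x c H
  weight-stepAt x ⟨ L , c , H ⟩ | tri≈ _ refl _ rewrite count-∷-≡ x [] = +-suc (length L) c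
  weight-stepAt x ⟨ L , c , H ⟩ | tri> _ _ a<x rewrite count-∷-≢ [] (≢-sym (<⇒≢ a<x)) = refl

  run : Word → Split → Split
  run [] t = t
  run (x ∷ w) t = run w (next (stepAt x t))

  runBumps : Word → Split → Word
  runBumps [] t = []
  runBumps (x ∷ w) t = fromMaybe (bump (stepAt x t)) ++ runBumps w (next (stepAt x t))

  misses : Word → Split → ℕ
  misses [] t = 0
  misses (x ∷ w) t = missCount (stepAt x t) + misses w (next (stepAt x t))

  separated-run : ∀ w t → Separated t → Separated (run w t)
  separated-run [] t sep = sep
  separated-run (x ∷ w) t sep = separated-run w _ (separated-stepAt x t sep)

  rowInserts-join : ∀ w t → Separated t → rowInserts (join t) w ≡ join (run w t)
  rowInserts-join [] t sep = refl
  rowInserts-join (x ∷ w) t sep rewrite rowInsert-join x t sep = rowInserts-join w _ (separated-stepAt x t sep)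

  rowBumps-join : ∀ w t → Separated t → rowBumps (join t) w ≡ runBumps w t
  rowBumps-join [] t sep = refl
  rowBumps-join (x ∷ w) t sep rewrite rowInsert-join x t sep =
    cong (fromMaybe (bump (stepAt x t)) ++_) (rowBumps-join w _ (separated-stepAt x t sep))

  weight-run : ∀ w t → weight (run w t) ≡ count a w + misses w t + weight t
  weight-run [] t = refl
  weight-run (x ∷ w) t rewrite weight-run w (next (stepAt x t)) | weight-stepAt x t | count-++ a [ x ] w =
    rearrange (count a w) (misses w _) (count a [ x ]) (missCount (stepAt x t)) (weight t)
    where
    rearrange : ∀ p q r s t → p + q + (r + s + t) ≡ r + p + (s + q) + t
    rearrange = solve-∀

  addCopies : ℕ → Split → Split
  addCopies k ⟨ L , c , H ⟩ = ⟨ L , c + k , H ⟩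

  stepAt-addCopies : ∀ k x t → missed (stepAt x t) ≡ false →
    next (stepAt x (addCopies k t)) ≡ addCopies k (next (stepAt x t))
      × bump (stepAt x (addCopies k t)) ≡ bump (stepAt x t)
  stepAt-addCopies k x ⟨ L , c , H ⟩ no-miss with <-cmp x a
  ... | tri< _ _ _ with rowInsert x L
  ...   | L′ , just y = refl , refl
  ...   | L′ , nothing = enterBelow-addCopies c no-miss
    where
    enterBelow-addCopies : ∀ c → missed (enterBelow L′ c H) ≡ false →
      next (enterBelow L′ (c + k) H) ≡ addCopies k (next (enterBelow L′ c H))
        × bump (enterBelow L′ (c + k) H) ≡ bump (enterBelow L′ c H)
    enterBelow-addCopies zero    ()
    enterBelow-addCopies (suc c) _ = refl , refl
  stepAt-addCopies k x ⟨ L , c , H ⟩ no-miss | tri≈ _ _ _ = refl , refl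
  stepAt-addCopies k x ⟨ L , c , H ⟩ no-miss | tri> _ _ _ = refl , refl

  run-addCopies : ∀ k w t → misses w t ≡ 0 →
    run w (addCopies k t) ≡ addCopies k (run w t) × runBumps w (addCopies k t) ≡ runBumps w t
  run-addCopies k [] t _ = refl , refl
  run-addCopies k (x ∷ w) t none with missed (stepAt x t) in missed≡
  ... | true = case none of λ ()
  ... | false rewrite proj₁ (stepAt-addCopies k x t missed≡) | proj₂ (stepAt-addCopies k x t missed≡) =
    let run≡ , bumps≡ = run-addCopies k w _ none in run≡ , cong (fromMaybe (bump (stepAt x t)) ++_) bumps≡

  below-enterBelow : ∀ L c H → below (next (enterBelow L c H)) ≡ L
  below-enterBelow L zero    H = refl
  below-enterBelow L (suc c) H = refl

  copies-enterBelow : ∀ L c H → copies (next (enterBelow L c H)) ≡ pred c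
  copies-enterBelow L zero    H = refl
  copies-enterBelow L (suc c) H = refl

  below-stepAt : ∀ x L c c′ H H′ → below (next (stepAt x ⟨ L , c , H ⟩)) ≡ below (next (stepAt x ⟨ L , c′ , H′ ⟩))
  below-stepAt x L c c′ H H′ with <-cmp x a
  ... | tri< _ _ _ with rowInsert x L
  ...   | L′ , just y  = refl
  ...   | L′ , nothing = trans (below-enterBelow L′ c H) (sym (below-enterBelow L′ c′ H′))
  below-stepAt x L c c′ H H′ | tri≈ _ _ _ = refl
  below-stepAt x L c c′ H H′ | tri> _ _ _ = refl

  copies-stepAt-gap : ∀ d x L c c′ H H′ → c ≤ c′ + d →
    copies (next (stepAt x ⟨ L , c , H ⟩)) ≤ copies (next (stepAt x ⟨ L , c′ , H′ ⟩)) + d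
  copies-stepAt-gap d x L c c′ H H′ c≤c′+d with <-cmp x a
  ... | tri< _ _ _ with rowInsert x L
  ...   | L′ , just y  = c≤c′+d
  ...   | L′ , nothing rewrite copies-enterBelow L′ c H | copies-enterBelow L′ c′ H′ =
    ≤-trans (pred-mono-≤ c≤c′+d) (pred-+ c′)
    where
    pred-+ : ∀ c′ → pred (c′ + d) ≤ pred c′ + d
    pred-+ zero     = pred[n]≤n
    pred-+ (suc c′) = ≤-refl
  copies-stepAt-gap d x L c c′ H H′ c≤c′+d | tri≈ _ _ _ = s≤s c≤c′+d
  copies-stepAt-gap d x L c c′ H H′ c≤c′+d | tri> _ _ _ = c≤c′+d

  copies-run-gap : ∀ d w S R → below S ≡ below R → copies S ≤ copies R + d → copies (run w S) ≤ copies (run w R) + d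
  copies-run-gap d [] S R _ le = le
  copies-run-gap d (x ∷ w) ⟨ L , c , H ⟩ ⟨ .L , c′ , H′ ⟩ refl le =
    copies-run-gap d w _ _ (below-stepAt x L c c′ H H′) (copies-stepAt-gap d x L c c′ H H′ le)

  below-run : ∀ w S R → below S ≡ below R → below (run w S) ≡ below (run w R)
  below-run [] S R eq = eq
  below-run (x ∷ w) ⟨ L , c , H ⟩ ⟨ .L , c′ , H′ ⟩ refl = below-run w _ _ (below-stepAt x L c c′ H H′)

  copies-stepAt-missed : ∀ k x t → missed (stepAt x t) ≡ true →
    copies (next (stepAt x (addCopies (suc k) t))) ≤ copies (next (stepAt x t)) + k
  copies-stepAt-missed k x ⟨ L , c , H ⟩ miss with <-cmp x a
  ... | tri< _ _ _ with rowInsert x L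
  ...   | L′ , just _  = case miss of λ ()
  ...   | L′ , nothing = enterBelow-missed c miss
    where
    enterBelow-missed : ∀ c → missed (enterBelow L′ c H) ≡ true →
      copies (next (enterBelow L′ (c + suc k) H)) ≤ copies (next (enterBelow L′ c H)) + k
    enterBelow-missed zero    _  = ≤-refl
    enterBelow-missed (suc c) ()
  copies-stepAt-missed k x ⟨ L , c , H ⟩ () | tri≈ _ _ _
  copies-stepAt-missed k x ⟨ L , c , H ⟩ () | tri> _ _ _

  copies-run-missed : ∀ k w t → 0 < misses w t → copies (run w (addCopies (suc k) t)) < copies (run w t) + suc k
  copies-run-missed k [] t ()
  copies-run-missed k (x ∷ w) t some with missed (stepAt x t) in missed≡
  ... | true = begin-strict
    copies (run w (next (stepAt x (addCopies (suc k) t))))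
      ≤⟨ copies-run-gap k w _ _ (below-stepAt x _ _ _ _ _) (copies-stepAt-missed k x t missed≡) ⟩
    copies (run w (next (stepAt x t))) + k      <⟨ +-monoʳ-< _ (n<1+n k) ⟩
    copies (run w (next (stepAt x t))) + suc k  ∎
    where open ≤-Reasoning
  ... | false rewrite proj₁ (stepAt-addCopies (suc k) x t missed≡) = copies-run-missed k w _ some

  stepAt-self : ∀ t → stepAt a t ≡ step ⟨ below t , suc (copies t) , drop 1 (above t) ⟩ (head (above t)) false
  stepAt-self ⟨ L , c , H ⟩ with <-cmp a a
  ... | tri< a<a _ _ = ⊥-elim (<-irrefl refl a<a)
  ... | tri≈ _ _ _   = refl
  ... | tri> _ _ a<a = ⊥-elim (<-irrefl refl a<a)

  run-replicate : ∀ k t → run (replicate k a) t ≡ ⟨ below t , copies t + k , drop k (above t) ⟩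
  run-replicate zero    ⟨ L , c , H ⟩ = cong (λ z → ⟨ L , z , H ⟩) (sym (+-identityʳ c))
  run-replicate (suc k) ⟨ L , c , H ⟩ rewrite stepAt-self ⟨ L , c , H ⟩ | run-replicate k ⟨ L , suc c , drop 1 H ⟩ | +-suc c k =
    cong (λ z → ⟨ L , suc (c + k) , z ⟩) (drop-drop-1 H)
    where
    drop-drop-1 : ∀ H → drop k (drop 1 H) ≡ drop (suc k) H
    drop-drop-1 []      = drop-[] k
    drop-drop-1 (_ ∷ H) = refl

  runBumps-replicate : ∀ k t → runBumps (replicate k a) t ≡ take k (above t)
  runBumps-replicate zero    t = refl
  runBumps-replicate (suc k) ⟨ L , c , H ⟩ rewrite stepAt-self ⟨ L , c , H ⟩ | runBumps-replicate k ⟨ L , suc c , drop 1 H ⟩ = take-drop-1 H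
    where
    take-drop-1 : ∀ H → fromMaybe (head H) ++ take k (drop 1 H) ≡ take (suc k) H
    take-drop-1 []      = take-[] k
    take-drop-1 (_ ∷ H) = refl

  length-join : ∀ t → length (join t) ≡ weight t + length (above t)
  length-join ⟨ L , c , H ⟩ rewrite length-++ L {replicate c a ++ H} | length-++ (replicate c a) {H} | length-replicate c {a} =
    sym (+-assoc (length L) c (length H))

  copies-join-injective : ∀ S R → Separated S → Separated R → below S ≡ below R → join S ≡ join R → copies S ≡ copies R
  copies-join-injective ⟨ L , c , H ⟩ ⟨ .L , c′ , H′ ⟩ (_ , a<H) (_ , a<H′) refl eq =
    replicate-injective c c′ a<H a<H′ (++-cancelˡ L _ _ eq)
    where
    replicate-injective : ∀ c c′ {H H′} → All (a <_) H → All (a <_) H′ →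
      replicate c a ++ H ≡ replicate c′ a ++ H′ → c ≡ c′
    replicate-injective zero    zero     _         _          _  = refl
    replicate-injective (suc c) (suc c′) a<H       a<H′       eq = cong suc (replicate-injective c c′ a<H a<H′ (∷-injectiveʳ eq))
    replicate-injective zero    (suc c′) (a<a ∷ _) _          refl = ⊥-elim (<-irrefl refl a<a)
    replicate-injective (suc c) zero     _         (a<a ∷ _)  refl = ⊥-elim (<-irrefl refl a<a)

  empty : Split
  empty = ⟨ [] , 0 , [] ⟩

  firstRow-replicate : ∀ k → firstRow (replicate k a) ≡ join (addCopies k empty)
  firstRow-replicate k = begin
    rowInserts (join empty) (replicate k a) ≡⟨ rowInserts-join (replicate k a) empty ([] , []) ⟩
    join (run (replicate k a) empty)        ≡⟨ cong join (run-replicate k empty) ⟩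
    join ⟨ [] , k , drop k [] ⟩             ≡⟨ cong (λ H → join ⟨ [] , k , H ⟩) (drop-[] k) ⟩
    join (addCopies k empty)                ∎
    where open ≡-Reasoning

  firstRow-replicate-++ : ∀ k w → firstRow (replicate k a ++ w) ≡ join (run w (addCopies k empty))
  firstRow-replicate-++ k w = begin
    rowInserts [] (replicate k a ++ w)        ≡⟨ rowInserts-++ [] (replicate k a) w ⟩
    rowInserts (firstRow (replicate k a)) w   ≡⟨ cong (λ r → rowInserts r w) (firstRow-replicate k) ⟩
    rowInserts (join (addCopies k empty)) w   ≡⟨ rowInserts-join w (addCopies k empty) ([] , []) ⟩
    join (run w (addCopies k empty))          ∎
    where open ≡-Reasoning

  rowBumps-replicate-++ : ∀ k w → rowBumps [] (replicate k a ++ w) ≡ runBumps w (addCopies k empty)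
  rowBumps-replicate-++ k w = begin
    rowBumps [] (replicate k a ++ w)
      ≡⟨ rowBumps-++ [] (replicate k a) w ⟩
    rowBumps (join empty) (replicate k a) ++ rowBumps (firstRow (replicate k a)) w
      ≡⟨ cong₂ _++_ (rowBumps-join (replicate k a) empty ([] , [])) (cong (λ r → rowBumps r w) (firstRow-replicate k)) ⟩
    runBumps (replicate k a) empty ++ rowBumps (join (addCopies k empty)) w
      ≡⟨ cong₂ _++_ (trans (runBumps-replicate k empty) (take-[] k)) (rowBumps-join w (addCopies k empty) ([] , [])) ⟩
    runBumps w (addCopies k empty)
      ∎
    where open ≡-Reasoning

  module _ (w : Word) where
    private
      t : Split
      t = run w empty
      separated-t : Separated t
      separated-t = separated-run w empty ([] , [])

    firstRow-++-replicate : ∀ k → firstRow (w ++ replicate k a) ≡ join ⟨ below t , copies t + k , drop k (above t) ⟩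
    firstRow-++-replicate k = begin
      rowInserts [] (w ++ replicate k a)    ≡⟨ rowInserts-++ [] w (replicate k a) ⟩
      rowInserts (firstRow w) (replicate k a) ≡⟨ cong (λ r → rowInserts r (replicate k a)) (rowInserts-join w empty ([] , [])) ⟩
      rowInserts (join t) (replicate k a)   ≡⟨ rowInserts-join (replicate k a) t separated-t ⟩
      join (run (replicate k a) t)          ≡⟨ cong join (run-replicate k t) ⟩
      join ⟨ below t , copies t + k , drop k (above t) ⟩ ∎
      where open ≡-Reasoning

    rowBumps-++-replicate : ∀ k → rowBumps [] (w ++ replicate k a) ≡ runBumps w empty ++ take k (above t)
    rowBumps-++-replicate k = begin
      rowBumps [] (w ++ replicate k a)
        ≡⟨ rowBumps-++ [] w (replicate k a) ⟩
      rowBumps (join empty) w ++ rowBumps (firstRow w) (replicate k a)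
        ≡⟨ cong₂ _++_ (rowBumps-join w empty ([] , [])) (cong (λ r → rowBumps r (replicate k a)) (rowInserts-join w empty ([] , []))) ⟩
      runBumps w empty ++ rowBumps (join t) (replicate k a)
        ≡⟨ cong (runBumps w empty ++_) (trans (rowBumps-join (replicate k a) t separated-t) (runBumps-replicate k t)) ⟩
      runBumps w empty ++ take k (above t)
        ∎
      where open ≡-Reasoning

    length-firstRow : length (firstRow w) ≡ count a w + misses w empty + length (above t)
    length-firstRow = begin
      length (rowInserts (join empty) w)  ≡⟨ cong length (rowInserts-join w empty ([] , [])) ⟩
      length (join t)                     ≡⟨ length-join t ⟩
      weight t + length (above t)         ≡⟨ cong (_+ length (above t)) (trans (weight-run w empty) (+-identityʳ _)) ⟩
      count a w + misses w empty + length (above t) ∎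
      where open ≡-Reasoning

    firstRow≤count⇒commute : ∀ k → length (firstRow w) ≤ count a w →
      (replicate (suc k) a ++ w) ≡ᴷ (w ++ replicate (suc k) a)
    firstRow≤count⇒commute k short = begin
      P (A ++ w)                                    ≡⟨ P-∷ a (replicate k a ++ w) ⟩
      firstRow (A ++ w) ∷ P (rowBumps [] (A ++ w))  ≡⟨ cong₂ (λ r b → r ∷ P b) rows bumps ⟩
      firstRow (w ++ A) ∷ P (rowBumps [] (w ++ A))  ≡⟨ sym (P-++-∷ w a (replicate k a)) ⟩
      P (w ++ A)                                    ∎
      where
      open ≡-Reasoning
      A : Word
      A = replicate (suc k) a
      no-extra : misses w empty ≡ 0 × length (above t) ≡ 0
      no-extra = m+n+o≤m⇒n≡0×o≡0 (count a w) (misses w empty) (length (above t))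
        (subst (_≤ count a w) length-firstRow short)
      no-above : above t ≡ []
      no-above = length≡0⇒[] (above t) (proj₂ no-extra)
      shifted : run w (addCopies (suc k) empty) ≡ addCopies (suc k) t
              × runBumps w (addCopies (suc k) empty) ≡ runBumps w empty
      shifted = run-addCopies (suc k) w empty (proj₁ no-extra)
      rows : firstRow (A ++ w) ≡ firstRow (w ++ A)
      rows = begin
        firstRow (A ++ w)                                  ≡⟨ firstRow-replicate-++ (suc k) w ⟩
        join (run w (addCopies (suc k) empty))             ≡⟨ cong join (proj₁ shifted) ⟩
        join ⟨ below t , copies t + suc k , above t ⟩      ≡⟨ cong (λ H → join ⟨ below t , copies t + suc k , H ⟩)
                                                                 (trans no-above (cong (drop (suc k)) (sym no-above))) ⟩
        join ⟨ below t , copies t + suc k , drop (suc k) (above t) ⟩ ≡⟨ sym (firstRow-++-replicate (suc k)) ⟩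
        firstRow (w ++ A)                                  ∎
      bumps : rowBumps [] (A ++ w) ≡ rowBumps [] (w ++ A)
      bumps = begin
        rowBumps [] (A ++ w)                           ≡⟨ rowBumps-replicate-++ (suc k) w ⟩
        runBumps w (addCopies (suc k) empty)           ≡⟨ proj₂ shifted ⟩
        runBumps w empty                               ≡⟨ sym (++-identityʳ _) ⟩
        runBumps w empty ++ take (suc k) []            ≡⟨ cong (λ H → runBumps w empty ++ take (suc k) H) (sym no-above) ⟩
        runBumps w empty ++ take (suc k) (above t)     ≡⟨ sym (rowBumps-++-replicate (suc k)) ⟩
        rowBumps [] (w ++ A)                           ∎

    commute⇒firstRow≡ : ∀ k → (replicate (suc k) a ++ w) ≡ᴷ (w ++ replicate (suc k) a) →
      join (run w (addCopies (suc k) empty)) ≡ join ⟨ below t , copies t + suc k , drop (suc k) (above t) ⟩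
    commute⇒firstRow≡ k commute = begin
      join (run w (addCopies (suc k) empty)) ≡⟨ sym (firstRow-replicate-++ (suc k) w) ⟩
      firstRow (replicate (suc k) a ++ w)    ≡⟨ ∷-injectiveˡ (trans (sym (P-∷ a (replicate k a ++ w)))
                                                                  (trans commute (P-++-∷ w a (replicate k a)))) ⟩
      firstRow (w ++ replicate (suc k) a)    ≡⟨ firstRow-++-replicate (suc k) ⟩
      join ⟨ below t , copies t + suc k , drop (suc k) (above t) ⟩ ∎
      where open ≡-Reasoning

    commute⇒firstRow≤count : ∀ k → (replicate (suc k) a ++ w) ≡ᴷ (w ++ replicate (suc k) a) →
      length (firstRow w) ≤ count a w
    commute⇒firstRow≤count k commute with misses w empty in m
    ... | zero = ≤-reflexive (begin
      length (firstRow w)                        ≡⟨ length-firstRow ⟩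
      count a w + misses w empty + length (above t) ≡⟨ cong₂ (λ p q → count a w + p + length q) m no-above ⟩
      count a w + 0 + 0                          ≡⟨ trans (+-identityʳ _) (+-identityʳ _) ⟩
      count a w                                  ∎)
      where
      open ≡-Reasoning
      shifted-rows : join ⟨ below t , copies t + suc k , above t ⟩
                   ≡ join ⟨ below t , copies t + suc k , drop (suc k) (above t) ⟩
      shifted-rows = trans (sym (cong join (proj₁ (run-addCopies (suc k) w empty m)))) (commute⇒firstRow≡ k commute)
      no-above : above t ≡ []
      no-above = ≡drop-suc⇒[] k (above t)
        (++-cancelˡ (replicate (copies t + suc k) a) _ _ (++-cancelˡ (below t) _ _ shifted-rows))
    ... | suc _ = ⊥-elim (<-irrefl same-copies (copies-run-missed k w empty (subst (0 <_) (sym m) z<s)))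
      where
      S : Split
      S = run w (addCopies (suc k) empty)
      same-copies : copies S ≡ copies t + suc k
      same-copies = copies-join-injective S ⟨ below t , copies t + suc k , drop (suc k) (above t) ⟩
        (separated-run w _ ([] , [])) (proj₁ separated-t , All.drop⁺ (suc k) (proj₂ separated-t))
        (below-run w _ _ refl) (commute⇒firstRow≡ k commute)

-- Schensted's theorem for the first row

count≤-rowInsert-mono : ∀ c x r → count≤ c r ≤ count≤ c (proj₁ (rowInsert x r))
count≤-rowInsert-mono c x [] = z≤n
count≤-rowInsert-mono c x (y ∷ r) with x <ᵇ y | <ᵇ-reflects-< x y
... | true | ofʸ x<y with y ≤? c
...   | yes y≤c rewrite count≤-∷-≤ r y≤c | count≤-∷-≤ r (≤-trans (<⇒≤ x<y) y≤c) = ≤-refl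
...   | no y≰c rewrite count≤-∷-> r (≰⇒> y≰c) = count≤-∷ x r
count≤-rowInsert-mono c x (y ∷ r) | false | _ with rowInsert x r | count≤-rowInsert-mono c x r
... | r′ , _ | r≤r′ with y ≤? c
...   | yes y≤c rewrite count≤-∷-≤ r y≤c | count≤-∷-≤ r′ y≤c = s≤s r≤r′
...   | no y≰c rewrite count≤-∷-> r (≰⇒> y≰c) | count≤-∷-> r′ (≰⇒> y≰c) = r≤r′

count≤-rowInsert-self : ∀ x r → count≤ x (proj₁ (rowInsert x r)) ≡ suc (count≤ x r)
count≤-rowInsert-self x [] = count≤-∷-≤ [] (≤-refl {x})
count≤-rowInsert-self x (y ∷ r) with x <ᵇ y | <ᵇ-reflects-< x y
... | true | ofʸ x<y rewrite count≤-∷-≤ r (≤-refl {x}) | count≤-∷-> r x<y = refl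
... | false | ofⁿ x≮y with rowInsert x r | count≤-rowInsert-self x r
...   | r′ , _ | r′≡ rewrite count≤-∷-≤ r′ (≮⇒≥ x≮y) | count≤-∷-≤ r (≮⇒≥ x≮y) = cong suc r′≡

count≤-rowInsert-above : ∀ {h x} r → h < x → count≤ h (proj₁ (rowInsert x r)) ≡ count≤ h r
count≤-rowInsert-above [] h<x = count≤-∷-> [] h<x
count≤-rowInsert-above {h} {x} (y ∷ r) h<x with x <ᵇ y | <ᵇ-reflects-< x y
... | true | ofʸ x<y rewrite count≤-∷-> r h<x | count≤-∷-> r (<-trans h<x x<y) = refl
... | false | _ with rowInsert x r | count≤-rowInsert-above r h<x
...   | r′ , _ | r′≡ with y ≤? h
...     | yes y≤h rewrite count≤-∷-≤ r y≤h | count≤-∷-≤ r′ y≤h = cong suc r′≡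
...     | no y≰h rewrite count≤-∷-> r (≰⇒> y≰h) | count≤-∷-> r′ (≰⇒> y≰h) = r′≡

count≤-rowInsert-below : ∀ {h x} r → Increasing r → x ≤ h →
  count≤ h (proj₁ (rowInsert x r)) ≡ count≤ h r ⊎ count≤ h (proj₁ (rowInsert x r)) ≡ suc (count≤ x r)
count≤-rowInsert-below [] [] x≤h = inj₂ (count≤-∷-≤ [] x≤h)
count≤-rowInsert-below {h} {x} (y ∷ r) (y≤r ∷ _) x≤h with x <ᵇ y | <ᵇ-reflects-< x y
... | true | ofʸ x<y with y ≤? h
...   | yes y≤h rewrite count≤-∷-≤ r x≤h | count≤-∷-≤ r y≤h = inj₁ refl
...   | no y≰h rewrite count≤-∷-≤ r x≤h | count≤-∷-> r x<y
                     | count≤-none r (All.map (<-≤-trans (≰⇒> y≰h)) y≤r)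
                     | count≤-none r (All.map (<-≤-trans x<y) y≤r) = inj₂ refl
count≤-rowInsert-below {h} {x} (y ∷ r) (_ ∷ inc) x≤h | false | ofⁿ x≮y
  rewrite count≤-∷-≤ r (≮⇒≥ x≮y) | count≤-∷-≤ r (≤-trans (≮⇒≥ x≮y) x≤h)
  with rowInsert x r | count≤-rowInsert-below r inc x≤h
... | r′ , _ | r′≡ rewrite count≤-∷-≤ r′ (≤-trans (≮⇒≥ x≮y) x≤h) = Sum.map (cong suc) (cong suc) r′≡

rowInserts-length-≥ : ∀ {c} r w {s} → s ⊆ w → Increasing s → All (c ≤_) s → count≤ c r + length s ≤ length (rowInserts r w)
rowInserts-length-≥ {c} r [] [] _ _ = subst (_≤ length r) (sym (+-identityʳ _)) (length-filter (_≤? c) r)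
rowInserts-length-≥ {c} r (x ∷ w) (.x ∷ʳ τ) inc c≤s =
  ≤-trans (+-monoˡ-≤ _ (count≤-rowInsert-mono c x r)) (rowInserts-length-≥ _ w τ inc c≤s)
rowInserts-length-≥ {c} r (x ∷ w) {x ∷ s} (refl ∷ τ) (x≤s ∷ inc) (c≤x ∷ _) = begin
  count≤ c r + suc (length s)                  ≡⟨ +-suc _ _ ⟩
  suc (count≤ c r) + length s                  ≤⟨ +-monoˡ-≤ _ (s≤s (count≤-mono r c≤x)) ⟩
  suc (count≤ x r) + length s                  ≡⟨ cong (_+ length s) (sym (count≤-rowInsert-self x r)) ⟩
  count≤ x (proj₁ (rowInsert x r)) + length s  ≤⟨ rowInserts-length-≥ _ w τ inc x≤s ⟩
  length (rowInserts (proj₁ (rowInsert x r)) w) ∎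
  where open ≤-Reasoning

-- Built from the end of w backwards: x is prepended to seq when inserting x raises the number of
-- entries ≤ floor.
record Witness (b : ℕ) (r : List ℕ) (w : Word) : Set where
  constructor witness
  field
    floor      : ℕ
    seq        : List ℕ
    seq⊆w      : seq ⊆ w
    increasing : Increasing seq
    floor≤seq  : All (floor ≤_) seq
    bound      : count≤ b (rowInserts r w) ≤ count≤ floor r + length seq

rowInserts-witness : ∀ b r w → Increasing r → Witness b r w
rowInserts-witness b r [] _ = witness b [] [] [] [] (≤-reflexive (sym (+-identityʳ _)))
rowInserts-witness b r (x ∷ w) inc with rowInserts-witness b (proj₁ (rowInsert x r)) w (rowInsert-increasing r inc)
... | witness h s τ inc-s h≤s bound with h <? x
...   | yes h<x = witness h s (x ∷ʳ τ) inc-s h≤s (subst (λ n → _ ≤ n + length s) (count≤-rowInsert-above r h<x) bound)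
...   | no h≮x with count≤-rowInsert-below r inc (≮⇒≥ h≮x)
...     | inj₁ same = witness h s (x ∷ʳ τ) inc-s h≤s (subst (λ n → _ ≤ n + length s) same bound)
...     | inj₂ more = witness x (x ∷ s) (refl ∷ τ) (x≤s ∷ inc-s) (≤-refl ∷ x≤s)
                        (subst (count≤ b (rowInserts (proj₁ (rowInsert x r)) w) ≤_)
                               (trans (cong (_+ length s) more) (sym (+-suc _ _))) bound)
  where
  x≤s : All (x ≤_) s
  x≤s = All.map (≤-trans (≮⇒≥ h≮x)) h≤s

increasing-≤-firstRow : ∀ {s w} → s ⊆ w → Increasing s → length s ≤ length (firstRow w)
increasing-≤-firstRow {s} {w} τ inc = rowInserts-length-≥ [] w τ inc (All.universal (λ _ → z≤n) s)

firstRow-increasing-witness : ∀ w → ∃[ s ] s ⊆ w × Increasing s × length (firstRow w) ≤ length s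
firstRow-increasing-witness w with rowInserts-witness (max 0 w) [] w []
... | witness _ s τ inc _ bound = s , τ , inc , subst (_≤ length s) all≤max bound
  where
  all≤max : count≤ (max 0 w) (firstRow w) ≡ length (firstRow w)
  all≤max = cong length (filter-all (_≤? max 0 w) (rowInserts-All [] w [] (xs≤max 0 w)))

Dominated : ℕ → Word → Set
Dominated a w = ∀ {s} → s ⊆ w → Increasing s → length s ≤ count a w

dominated⇔firstRow≤count : ∀ a w → Dominated a w ⇔ length (firstRow w) ≤ count a w
dominated⇔firstRow≤count a w = mk⇔
  (λ dom → let s , τ , inc , row≤s = firstRow-increasing-witness w in ≤-trans row≤s (dom τ inc))
  (λ row≤ {_} τ inc → ≤-trans (increasing-≤-firstRow τ inc) row≤)

dominated-long : ∀ {a lo n w} → Dominated a w → LongIncreasing lo n w → n ≤ count a w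
dominated-long dom (long τ inc _ n≤) = ≤-trans n≤ (dom τ inc)

-- Raising the unmatched letters a

-- Reading a word left to right, a + 1 opens a bracket and a closes the most recently opened one;
-- the counter p is the number of open brackets.  raise turns every a with nothing to close into a + 1.
module Bracketing (a : ℕ) where

  data Letter (x : ℕ) : Set where
    is-a  : x ≡ a → Letter x
    is-b  : x ≡ suc a → Letter x
    other : x ≢ a → x ≢ suc a → Letter x

  letter : ∀ x → Letter x
  letter x with x ≟ a | x ≟ suc a
  ... | yes x≡a | _       = is-a x≡a
  ... | no _    | yes x≡b = is-b x≡b
  ... | no x≢a  | no x≢b  = other x≢a x≢b

  a≢b : a ≢ suc a
  a≢b = ≢-sym 1+n≢n

  emit : ∀ {x} → ℕ → Letter x → ℕ
  emit p       (is-b _)    = suc a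
  emit {x} p   (other _ _) = x
  emit zero    (is-a _)    = suc a
  emit (suc p) (is-a _)    = a

  carry : ∀ {x} → ℕ → Letter x → ℕ
  carry p       (is-b _)    = suc p
  carry p       (other _ _) = p
  carry zero    (is-a _)    = 0
  carry (suc p) (is-a _)    = p

  raisedHere : ∀ {x} → ℕ → Letter x → ℕ
  raisedHere p       (is-b _)    = 0
  raisedHere p       (other _ _) = 0
  raisedHere zero    (is-a _)    = 1
  raisedHere (suc p) (is-a _)    = 0

  raise : ℕ → Word → Word
  raise p [] = []
  raise p (x ∷ w) = emit p (letter x) ∷ raise (carry p (letter x)) w

  unmatched : ℕ → Word → ℕ
  unmatched p [] = p
  unmatched p (x ∷ w) = unmatched (carry p (letter x)) w

  raised : ℕ → Word → ℕ
  raised p [] = 0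
  raised p (x ∷ w) = raisedHere p (letter x) + raised (carry p (letter x)) w

  length-raise : ∀ p w → length (raise p w) ≡ length w
  length-raise p [] = refl
  length-raise p (x ∷ w) = cong suc (length-raise _ w)

  raise-All : ∀ {P : ℕ → Set} p w → P (suc a) → All P w → All P (raise p w)
  raise-All p [] _ [] = []
  raise-All {P} p (x ∷ w) pb (px ∷ pw) = emit-All p (letter x) ∷ raise-All _ w pb pw
    where
    emit-All : ∀ p (ℓ : Letter x) → P (emit p ℓ)
    emit-All p       (is-b _)    = pb
    emit-All p       (other _ _) = px
    emit-All zero    (is-a _)    = pb
    emit-All (suc p) (is-a refl) = px

  count-raise : ∀ p w → count (suc a) (raise p w) ≡ count (suc a) w + raised p w
  count-raise p [] = refl
  count-raise p (x ∷ w) with letter x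
  count-raise zero (x ∷ w) | is-a refl
    rewrite count-∷-≡ (suc x) (raise 0 w) | count-∷-≢ w a≢b | count-raise 0 w = sym (+-suc _ _)
  count-raise (suc p) (x ∷ w) | is-a refl
    rewrite count-∷-≢ (raise p w) a≢b | count-∷-≢ w a≢b = count-raise p w
  ... | is-b refl rewrite count-∷-≡ x (raise (suc p) w) | count-∷-≡ x w = cong suc (count-raise (suc p) w)
  ... | other _ x≢b rewrite count-∷-≢ (raise p w) x≢b | count-∷-≢ w x≢b = count-raise p w

  count-balance : ∀ p w → unmatched p w + count a w ≡ p + count (suc a) w + raised p w
  count-balance p [] = sym (+-identityʳ _)
  count-balance p (x ∷ w) with letter x
  count-balance zero (x ∷ w) | is-a refl
    rewrite count-∷-≡ x w | count-∷-≢ w a≢b = trans (+-suc _ _) (trans (cong suc (count-balance 0 w)) (sym (+-suc _ _)))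
  count-balance (suc p) (x ∷ w) | is-a refl
    rewrite count-∷-≡ x w | count-∷-≢ w a≢b = trans (+-suc _ _) (cong suc (count-balance p w))
  ... | is-b refl rewrite count-∷-≡ x w | count-∷-≢ w (≢-sym a≢b) =
    trans (count-balance (suc p) w) (cong (_+ raised (suc p) w) (sym (+-suc p _)))
  ... | other x≢a x≢b rewrite count-∷-≢ w x≢a | count-∷-≢ w x≢b = count-balance p w

  raised-long : ∀ p w → raised p w ≡ 0 ⊎ LongIncreasing a (p + count (suc a) w + raised p w) w
  raised-long p [] = inj₁ refl
  raised-long p (x ∷ w) with letter x
  raised-long zero (x ∷ w) | is-a refl rewrite count-∷-≢ w a≢b with raised-long 0 w
  ... | inj₁ none rewrite none =
    inj₂ (weaken ≤-refl (≤-reflexive (+-comm _ 1)) (prepend ≤-refl (n≤1+n x) (occurrences-increasing (suc x) w)))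
  ... | inj₂ li = inj₂ (weaken ≤-refl (≤-reflexive (+-suc _ _)) (prepend ≤-refl ≤-refl li))
  raised-long (suc p) (x ∷ w) | is-a refl rewrite count-∷-≢ w a≢b = Sum.map₂ (prepend ≤-refl ≤-refl) (raised-long p w)
  raised-long p (x ∷ w) | is-b refl rewrite count-∷-≡ x w =
    Sum.map₂ (skip x ∘ weaken ≤-refl (≤-reflexive (cong (_+ raised (suc p) w) (+-suc p _)))) (raised-long (suc p) w)
  raised-long p (x ∷ w) | other _ x≢b rewrite count-∷-≢ w x≢b = Sum.map₂ (skip x) (raised-long p w)

  dominated⇒balanced : ∀ w → Dominated a w → count (suc a) w + raised 0 w ≤ count a w
  dominated⇒balanced w dom with raised-long 0 w
  ... | inj₁ none rewrite none | +-identityʳ (count (suc a) w) = dominated-long dom (occurrences-increasing (suc a) w)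
  ... | inj₂ li = dominated-long dom li

  dominated⇒unmatched≡0 : ∀ w → Dominated a w → unmatched 0 w ≡ 0
  dominated⇒unmatched≡0 w dom = n≤0⇒n≡0 (+-cancelʳ-≤ (count a w) (unmatched 0 w) 0 (begin
    unmatched 0 w + count a w       ≡⟨ count-balance 0 w ⟩
    count (suc a) w + raised 0 w    ≤⟨ dominated⇒balanced w dom ⟩
    count a w                       ∎))
    where open ≤-Reasoning

  count-raise-dominated : ∀ w → Dominated a w → count (suc a) (raise 0 w) ≡ count a w
  count-raise-dominated w dom = begin
    count (suc a) (raise 0 w)     ≡⟨ count-raise 0 w ⟩
    count (suc a) w + raised 0 w  ≡⟨ sym (count-balance 0 w) ⟩
    unmatched 0 w + count a w     ≡⟨ cong (_+ count a w) (dominated⇒unmatched≡0 w dom) ⟩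
    count a w                     ∎
    where open ≡-Reasoning

  raise-⊆-above : ∀ p w {s} → s ⊆ raise p w → All (suc (suc a) ≤_) s → s ⊆ w
  raise-⊆-above p [] [] _ = []
  raise-⊆-above p (x ∷ w) (_ ∷ʳ τ) big = x ∷ʳ raise-⊆-above _ w τ big
  raise-⊆-above p (x ∷ w) (refl ∷ τ) (big-e ∷ big) with letter x
  ... | other _ _ = refl ∷ raise-⊆-above p w τ big
  ... | is-b _    = ⊥-elim (1+n≰n big-e)
  raise-⊆-above zero    (x ∷ w) (refl ∷ τ) (big-e ∷ big) | is-a _ = ⊥-elim (1+n≰n big-e)
  raise-⊆-above (suc p) (x ∷ w) (refl ∷ τ) (big-e ∷ big) | is-a _ = ⊥-elim (1+n≰n (≤-trans (n≤1+n _) big-e))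

  raise-long-above : ∀ p w {s} → s ⊆ raise p w → Increasing s → All (suc a ≤_) s →
    LongIncreasing (suc a) (length s) w ⊎ LongIncreasing a (p + length s) w
  raise-long-above p [] [] _ _ = inj₁ (long [] [] [] z≤n)
  raise-long-above p (x ∷ w) (_ ∷ʳ τ) inc b≤s with letter x
  raise-long-above zero (x ∷ w) (_ ∷ʳ τ) inc b≤s | is-a _ =
    Sum.map (skip x) (skip x) (raise-long-above 0 w τ inc b≤s)
  raise-long-above (suc p) (x ∷ w) (_ ∷ʳ τ) inc b≤s | is-a refl =
    Sum.map (skip x) (prepend ≤-refl ≤-refl) (raise-long-above p w τ inc b≤s)
  ... | is-b _ = Sum.map (skip x) (skip x ∘ weaken ≤-refl (n≤1+n _)) (raise-long-above (suc p) w τ inc b≤s)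
  ... | other _ _ = Sum.map (skip x) (skip x) (raise-long-above p w τ inc b≤s)
  raise-long-above p (x ∷ w) (refl ∷ τ) (e≤s ∷ inc) (b≤e ∷ b≤s) with letter x
  raise-long-above zero (x ∷ w) (refl ∷ τ) (e≤s ∷ inc) (b≤e ∷ b≤s) | is-a refl =
    inj₂ (Sum.[ prepend ≤-refl (n≤1+n x) , prepend ≤-refl ≤-refl ] (raise-long-above 0 w τ inc e≤s))
  raise-long-above (suc p) (x ∷ w) (refl ∷ τ) _ (b≤e ∷ _) | is-a refl = ⊥-elim (1+n≰n b≤e)
  raise-long-above p (x ∷ w) (refl ∷ τ) (e≤s ∷ inc) (b≤e ∷ b≤s) | is-b refl =
    Sum.map (prepend ≤-refl ≤-refl) (skip x ∘ weaken ≤-refl (≤-reflexive (+-suc p _)))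
      (raise-long-above (suc p) w τ inc e≤s)
  raise-long-above p (x ∷ w) (refl ∷ τ) (e≤s ∷ inc) (b≤e ∷ b≤s) | other _ x≢b =
    inj₁ (long (refl ∷ raise-⊆-above p w τ (All.map (≤-trans a+2≤x) e≤s)) (e≤s ∷ inc) (b≤e ∷ b≤s) ≤-refl)
    where
    a+2≤x : suc (suc a) ≤ x
    a+2≤x = ≤∧≢⇒< b≤e (≢-sym x≢b)

  raise-long : ∀ {lo} p w {s} → lo ≤ a → s ⊆ raise p w → Increasing s → All (lo ≤_) s →
    LongIncreasing lo (length s) w
  raise-long p [] lo≤a [] _ _ = long [] [] [] z≤n
  raise-long p (x ∷ w) lo≤a (_ ∷ʳ τ) inc lo≤s = skip x (raise-long _ w lo≤a τ inc lo≤s)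
  raise-long p (x ∷ w) lo≤a (refl ∷ τ) (e≤s ∷ inc) (lo≤e ∷ lo≤s) with letter x
  raise-long zero (x ∷ w) lo≤a (refl ∷ τ) (e≤s ∷ inc) (lo≤e ∷ lo≤s) | is-a refl =
    Sum.[ prepend lo≤a (n≤1+n x) , prepend lo≤a ≤-refl ] (raise-long-above 0 w τ inc e≤s)
  raise-long (suc p) (x ∷ w) lo≤a (refl ∷ τ) (e≤s ∷ inc) (lo≤e ∷ lo≤s) | is-a refl =
    prepend lo≤a ≤-refl (raise-long p w ≤-refl τ inc e≤s)
  raise-long p (x ∷ w) lo≤a (refl ∷ τ) (e≤s ∷ inc) (lo≤e ∷ lo≤s) | is-b refl =
    Sum.[ prepend lo≤e ≤-refl , skip x ∘ weaken lo≤a (s≤s (m≤n+m _ p)) ] (raise-long-above (suc p) w τ inc e≤s)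
  raise-long p (x ∷ w) lo≤a (refl ∷ τ) (e≤s ∷ inc) (lo≤e ∷ lo≤s) | other x≢a x≢b with x <? a
  ... | yes x<a = prepend lo≤e ≤-refl (raise-long p w (<⇒≤ x<a) τ inc e≤s)
  ... | no x≮a = long (refl ∷ raise-⊆-above p w τ (All.map (≤-trans a+2≤x) e≤s)) (e≤s ∷ inc) (lo≤e ∷ lo≤s) ≤-refl
    where
    a+2≤x : suc (suc a) ≤ x
    a+2≤x = ≤∧≢⇒< (≤∧≢⇒< (≮⇒≥ x≮a) (≢-sym x≢a)) (≢-sym x≢b)

  dominated-raise : ∀ w → Dominated a w → Dominated (suc a) (raise 0 w)
  dominated-raise w dom {s} τ inc = begin
    length s                   ≤⟨ dominated-long dom (raise-long 0 w z≤n τ inc (All.universal (λ _ → z≤n) s)) ⟩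
    count a w                  ≡⟨ sym (count-raise-dominated w dom) ⟩
    count (suc a) (raise 0 w)  ∎
    where open ≤-Reasoning

  carry-gap : ∀ {p q x₁ x₂} (ℓ₁ : Letter x₁) (ℓ₂ : Letter x₂) →
    emit p ℓ₁ ≡ emit q ℓ₂ → q < p → carry q ℓ₂ < carry p ℓ₁
  carry-gap {suc p} {suc q} (is-a _)      (is-a _)      _ q<p = ≤-pred q<p
  carry-gap {suc p} {zero}  (is-a _)      (is-a _)      e _   = ⊥-elim (a≢b e)
  carry-gap {suc p}         (is-a _)      (is-b _)      e _   = ⊥-elim (a≢b e)
  carry-gap {suc p}         (is-a _)      (other x≢a _) e _   = ⊥-elim (x≢a (sym e))
  carry-gap {q = zero}      (is-b _)      (is-a _)      _ _   = s≤s z≤n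
  carry-gap {q = suc q}     (is-b _)      (is-a _)      e _   = ⊥-elim (a≢b (sym e))
  carry-gap                 (is-b _)      (is-b _)      _ q<p = s≤s q<p
  carry-gap                 (is-b _)      (other _ x≢b) e _   = ⊥-elim (x≢b (sym e))
  carry-gap                 (other _ _)   (other _ _)   _ q<p = q<p
  carry-gap {q = zero}      (other _ x≢b) (is-a _)      e _   = ⊥-elim (x≢b e)
  carry-gap {q = suc q}     (other x≢a _) (is-a _)      e _   = ⊥-elim (x≢a e)
  carry-gap                 (other _ x≢b) (is-b _)      e _   = ⊥-elim (x≢b e)

  unmatched-gap : ∀ p q w₁ w₂ → raise p w₁ ≡ raise q w₂ → q < p → unmatched q w₂ < unmatched p w₁
  unmatched-gap p q []        []        _  q<p = q<p
  unmatched-gap p q (x₁ ∷ w₁) (x₂ ∷ w₂) eq q<p =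
    unmatched-gap _ _ w₁ w₂ (∷-injectiveʳ eq) (carry-gap (letter x₁) (letter x₂) (∷-injectiveˡ eq) q<p)

  same-carry : ∀ p q w₁ w₂ → raise p w₁ ≡ raise q w₂ → unmatched p w₁ ≡ 0 → unmatched q w₂ ≡ 0 → p ≡ q
  same-carry p q w₁ w₂ eq u₁ u₂ with <-cmp p q
  ... | tri< p<q _ _ = ⊥-elim (n≮0 (subst₂ _<_ u₁ u₂ (unmatched-gap q p w₂ w₁ (sym eq) p<q)))
  ... | tri≈ _ p≡q _ = p≡q
  ... | tri> _ _ q<p = ⊥-elim (n≮0 (subst₂ _<_ u₂ u₁ (unmatched-gap p q w₁ w₂ eq q<p)))

  emit-injective : ∀ {p x₁ x₂} (ℓ₁ : Letter x₁) (ℓ₂ : Letter x₂) →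
    emit p ℓ₁ ≡ emit p ℓ₂ → carry p ℓ₁ ≡ carry p ℓ₂ → x₁ ≡ x₂
  emit-injective         (is-a refl)    (is-a refl)     _ _ = refl
  emit-injective         (is-b refl)    (is-b refl)     _ _ = refl
  emit-injective         (other _ _)    (other _ _)     e _ = e
  emit-injective {zero}  (is-a _)       (is-b _)        _ ()
  emit-injective {suc p} (is-a _)       (is-b _)        e _ = ⊥-elim (a≢b e)
  emit-injective {zero}  (is-a _)       (other _ x≢b)   e _ = ⊥-elim (x≢b (sym e))
  emit-injective {suc p} (is-a _)       (other x≢a _)   e _ = ⊥-elim (x≢a (sym e))
  emit-injective {zero}  (is-b _)       (is-a _)        _ ()
  emit-injective {suc p} (is-b _)       (is-a _)        e _ = ⊥-elim (a≢b (sym e))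
  emit-injective         (is-b _)       (other _ x≢b)   e _ = ⊥-elim (x≢b (sym e))
  emit-injective {zero}  (other _ x≢b)  (is-a _)        e _ = ⊥-elim (x≢b e)
  emit-injective {suc p} (other x≢a _)  (is-a _)        e _ = ⊥-elim (x≢a e)
  emit-injective         (other _ x≢b)  (is-b _)        e _ = ⊥-elim (x≢b e)

  raise-injective : ∀ p q w₁ w₂ → raise p w₁ ≡ raise q w₂ →
    unmatched p w₁ ≡ 0 → unmatched q w₂ ≡ 0 → w₁ ≡ w₂
  raise-injective p q []        []        _  _  _  = refl
  raise-injective p q (x₁ ∷ w₁) (x₂ ∷ w₂) eq u₁ u₂ with same-carry p q (x₁ ∷ w₁) (x₂ ∷ w₂) eq u₁ u₂
  ... | refl = cong₂ _∷_
    (emit-injective (letter x₁) (letter x₂) (∷-injectiveˡ eq) (same-carry _ _ w₁ w₂ (∷-injectiveʳ eq) u₁ u₂))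
    (raise-injective _ _ w₁ w₂ (∷-injectiveʳ eq) u₁ u₂)

-- Reverse complement

InRange : ℕ → ℕ → Set
InRange m y = 1 ≤ y × y ≤ m

complement : ℕ → Word → Word
complement m w = reverse (map (suc m ∸_) w)

length-complement : ∀ m w → length (complement m w) ≡ length w
length-complement m w = trans (length-reverse (map (suc m ∸_) w)) (length-map (suc m ∸_) w)

complement-involutive : ∀ m {w} → All (InRange m) w → complement m (complement m w) ≡ w
complement-involutive m {w} in-range = begin
  reverse (map f (reverse (map f w)))  ≡⟨ cong reverse (reverse-map f (map f w)) ⟩
  reverse (reverse (map f (map f w)))  ≡⟨ reverse-involutive _ ⟩
  map f (map f w)                      ≡⟨ sym (map-∘ w) ⟩
  map (f ∘ f) w                        ≡⟨ map-id-local (All.map (λ (_ , y≤m) → m∸[m∸n]≡n (m≤n⇒m≤1+n y≤m)) in-range) ⟩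
  w                                    ∎
  where
  open ≡-Reasoning
  f : ℕ → ℕ
  f = suc m ∸_

complement-InRange : ∀ m {w} → All (InRange m) w → All (InRange m) (complement m w)
complement-InRange m in-range = All-reverse (All.map⁺ (All.map complement-letter in-range))
  where
  complement-letter : ∀ {y} → InRange m y → InRange m (suc m ∸ y)
  complement-letter (1≤y , y≤m) = subst (1 ≤_) (sym (+-∸-assoc 1 y≤m)) (s≤s z≤n) , ∸-monoʳ-≤ (suc m) 1≤y

⊆-complement : ∀ m {s w} → s ⊆ w → complement m s ⊆ complement m w
⊆-complement m τ = Sublist.reverse⁺ (Sublist.map⁺ (suc m ∸_) τ)

increasing-complement : ∀ m {s} → Increasing s → Increasing (complement m s)
increasing-complement m inc = AllPairs-reverse (AllPairs.map⁺ (AllPairs.map (∸-monoʳ-≤ (suc m)) inc))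

count-complement : ∀ m {w} → All (InRange m) w → count 1 (complement m w) ≡ count m w
count-complement m {w} in-range = trans (↭-length (filter-↭ (_≟ 1) (↭-reverse (map (suc m ∸_) w)))) (count-map in-range)
  where
  count-map : ∀ {w} → All (InRange m) w → count 1 (map (suc m ∸_) w) ≡ count m w
  count-map [] = refl
  count-map {y ∷ w} ((_ , y≤m) ∷ in-range) with y ≟ m
  ... | yes refl = trans (cong (λ z → count 1 (z ∷ map (suc y ∸_) w)) (m+n∸n≡m 1 y))
                    (trans (count-∷-≡ 1 (map (suc y ∸_) w)) (trans (cong suc (count-map in-range)) (sym (count-∷-≡ y w))))
  ... | no y≢m = trans (count-∷-≢ _ complement≢1) (trans (count-map in-range) (sym (count-∷-≢ w y≢m)))
    where
    complement≢1 : suc m ∸ y ≢ 1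
    complement≢1 eq = m>n⇒m∸n≢0 (≤∧≢⇒< y≤m y≢m) (suc-injective (trans (sym (+-∸-assoc 1 y≤m)) eq))

dominated-complement : ∀ m w → All (InRange m) w → Dominated m w → Dominated 1 (complement m w)
dominated-complement m w in-range dom {s} τ inc = begin
  length s                  ≡⟨ sym (length-complement m s) ⟩
  length (complement m s)   ≤⟨ dom (subst (complement m s ⊆_) (complement-involutive m in-range) (⊆-complement m τ))
                                   (increasing-complement m inc) ⟩
  count m w                 ≡⟨ sym (count-complement m in-range) ⟩
  count 1 (complement m w)  ∎
  where open ≤-Reasoning

∈-letters⁻ : ∀ {m i} → i ∈ letters m → InRange m i
∈-letters⁻ i∈ with ∈-map⁻ suc i∈
... | j , j∈ , refl = s≤s z≤n , ∈-upTo⁻ j∈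

∈-words⁻ : ∀ n m {w} → w ∈ words n m → length w ≡ n × All (InRange m) w
∈-words⁻ zero    m (here refl) = refl , []
∈-words⁻ (suc n) m w∈ with find (∈-concatMap⁻ (λ v → map (_∷ v) (letters m)) {xs = words n m} w∈)
... | v , v∈ , w∈ with ∈-map⁻ (_∷ v) w∈
...   | i , i∈ , refl = let length-v , v-in-range = ∈-words⁻ n m v∈ in cong suc length-v , ∈-letters⁻ i∈ ∷ v-in-range

∈-words⁺ : ∀ n m {w} → length w ≡ n → All (InRange m) w → w ∈ words n m
∈-words⁺ zero    m {[]}        _   _                  = here refl
∈-words⁺ (suc n) m {suc j ∷ w} len ((_ , j<m) ∷ in-range) =
  ∈-concatMap⁺ (λ v → map (_∷ v) (letters m)) {xs = words n m}
    (lose (∈-words⁺ n m (suc-injective len) in-range) (∈-map⁺ (_∷ w) (∈-map⁺ suc (∈-upTo⁺ j<m))))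

words-unique : ∀ n m → Unique (words n m)
words-unique zero    m = [] ∷ []
words-unique (suc n) m = Unique.concat⁺ (All.map⁺ (All.universal extensions-unique (words n m)))
                                        (AllPairs.map⁺ (AllPairs.map extensions-disjoint (words-unique n m)))
  where
  extensions : Word → List Word
  extensions v = map (_∷ v) (letters m)
  extensions-unique : ∀ v → Unique (extensions v)
  extensions-unique v = Unique.map⁺ ∷-injectiveˡ (Unique.map⁺ suc-injective (Unique.upTo⁺ m))
  extensions-disjoint : ∀ {v₁ v₂} → v₁ ≢ v₂ → Disjoint (extensions v₁) (extensions v₂)
  extensions-disjoint v₁≢v₂ (u∈₁ , u∈₂) with ∈-map⁻ (_∷ _) u∈₁ | ∈-map⁻ (_∷ _) u∈₂
  ... | _ , _ , refl | _ , _ , eq = v₁≢v₂ (∷-injectiveʳ eq)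

dominated? : ∀ a → Decidable (Dominated a)
dominated? a w = Dec.map′ from to (length (firstRow w) ≤? count a w)
  where open Equivalence (dominated⇔firstRow≤count a w)

dominatedCount : ℕ → ℕ → ℕ → ℕ
dominatedCount a n m = length (filter (dominated? a) (words n m))

c-replicate≡dominatedCount : ∀ a k n m → c n m (replicate (suc k) a) ≡ dominatedCount a n m
c-replicate≡dominatedCount a k n m = cong length (filter-≐ commutes? (dominated? a) (commute⇒dominated , dominated⇒commute) (words n m))
  where
  commutes? : Decidable (λ w → (replicate (suc k) a ++ w) ≡ᴷ (w ++ replicate (suc k) a))
  commutes? w = (replicate (suc k) a ++ w) ≡ᴷ? (w ++ replicate (suc k) a)
  commute⇒dominated : ∀ {w} → (replicate (suc k) a ++ w) ≡ᴷ (w ++ replicate (suc k) a) → Dominated a w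
  commute⇒dominated {w} = Equivalence.from (dominated⇔firstRow≤count a w) ∘ AroundLetter.commute⇒firstRow≤count a w k
  dominated⇒commute : ∀ {w} → Dominated a w → (replicate (suc k) a ++ w) ≡ᴷ (w ++ replicate (suc k) a)
  dominated⇒commute {w} = AroundLetter.firstRow≤count⇒commute a w k ∘ Equivalence.to (dominated⇔firstRow≤count a w)

dominatedCount-raise : ∀ a n m → suc a ≤ m → dominatedCount a n m ≤ dominatedCount (suc a) n m
dominatedCount-raise a n m a<m = filter-length-≤ (dominated? a) (dominated? (suc a)) (words-unique n m) (raise 0) into injective
  where
  open Bracketing a
  into : ∀ {w} → w ∈ words n m → Dominated a w → raise 0 w ∈ words n m × Dominated (suc a) (raise 0 w)
  into {w} w∈ dom = let length-w , in-range = ∈-words⁻ n m w∈ in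
    ∈-words⁺ n m (trans (length-raise 0 w) length-w) (raise-All 0 w (s≤s z≤n , a<m) in-range) , dominated-raise w dom
  injective : ∀ {w₁ w₂} → w₁ ∈ words n m → w₂ ∈ words n m → Dominated a w₁ → Dominated a w₂ →
    raise 0 w₁ ≡ raise 0 w₂ → w₁ ≡ w₂
  injective {w₁} {w₂} _ _ dom₁ dom₂ eq =
    raise-injective 0 0 w₁ w₂ eq (dominated⇒unmatched≡0 w₁ dom₁) (dominated⇒unmatched≡0 w₂ dom₂)

dominatedCount-complement : ∀ n m → dominatedCount m n m ≤ dominatedCount 1 n m
dominatedCount-complement n m = filter-length-≤ (dominated? m) (dominated? 1) (words-unique n m) (complement m) into injective
  where
  into : ∀ {w} → w ∈ words n m → Dominated m w → complement m w ∈ words n m × Dominated 1 (complement m w)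
  into {w} w∈ dom = let length-w , in-range = ∈-words⁻ n m w∈ in
    ∈-words⁺ n m (trans (length-complement m w) length-w) (complement-InRange m in-range) , dominated-complement m w in-range dom
  injective : ∀ {w₁ w₂} → w₁ ∈ words n m → w₂ ∈ words n m → Dominated m w₁ → Dominated m w₂ →
    complement m w₁ ≡ complement m w₂ → w₁ ≡ w₂
  injective w₁∈ w₂∈ _ _ eq = trans (sym (complement-involutive m (proj₂ (∈-words⁻ n m w₁∈))))
                                   (trans (cong (complement m) eq) (complement-involutive m (proj₂ (∈-words⁻ n m w₂∈))))

dominatedCount-mono : ∀ n m {a b} → a ≤′ b → b ≤ m → dominatedCount a n m ≤ dominatedCount b n m
dominatedCount-mono n m ≤′-refl           _   = ≤-refl
dominatedCount-mono n m (≤′-step a≤′b) b<m = ≤-trans (dominatedCount-mono n m a≤′b (<⇒≤ b<m)) (dominatedCount-raise _ n m b<m)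

dominatedCount-constant : ∀ a n m → 1 ≤ a → a ≤ m → dominatedCount a n m ≡ dominatedCount 1 n m
dominatedCount-constant a n m 1≤a a≤m = ≤-antisym
  (≤-trans (dominatedCount-mono n m (≤⇒≤′ a≤m) ≤-refl) (dominatedCount-complement n m))
  (dominatedCount-mono n m (≤⇒≤′ 1≤a) a≤m)

dominatedCount-absent : ∀ a n m → m < a → dominatedCount a n m ≡ δ₀ n
dominatedCount-absent a zero    m _   = refl
dominatedCount-absent a (suc n) m m<a = cong length (filter-none (dominated? a) (All.tabulate not-dominated))
  where
  not-dominated : ∀ {w} → w ∈ words (suc n) m → ¬ Dominated a w
  not-dominated {[]} w∈ _ with () ← proj₁ (∈-words⁻ (suc n) m w∈)
  not-dominated {x ∷ v} w∈ dom = 1+n≰n (begin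
    1                 ≤⟨ dom (refl ∷ minimum v) ([] ∷ []) ⟩
    count a (x ∷ v)   ≡⟨ cong length (filter-none (_≟ a) no-a) ⟩
    0                 ∎)
    where
    open ≤-Reasoning
    no-a : All (_≢ a) (x ∷ v)
    no-a = All.map (λ (_ , y≤m) → <⇒≢ (≤-<-trans y≤m m<a)) (proj₂ (∈-words⁻ (suc n) m w∈))

corollary5p2 : (a k n m : ℕ) → 1 ≤ a → 1 ≤ k → 1 ≤ m →
      (a ≤ m → c n m (replicate k a) ≡ c n m (1 ∷ []))
    × (m < a → c n m (replicate k a) ≡ δ₀ n)
corollary5p2 a zero    n m _   () _
corollary5p2 a (suc k) n m 1≤a _  _ = same-as-one , absent
  where
  same-as-one : a ≤ m → c n m (replicate (suc k) a) ≡ c n m (1 ∷ [])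
  same-as-one a≤m = begin
    c n m (replicate (suc k) a)  ≡⟨ c-replicate≡dominatedCount a k n m ⟩
    dominatedCount a n m         ≡⟨ dominatedCount-constant a n m 1≤a a≤m ⟩
    dominatedCount 1 n m         ≡⟨ sym (c-replicate≡dominatedCount 1 0 n m) ⟩
    c n m (1 ∷ [])               ∎
    where open ≡-Reasoning
  absent : m < a → c n m (replicate (suc k) a) ≡ δ₀ n
  absent m<a = trans (c-replicate≡dominatedCount a k n m) (dominatedCount-absent a n m m<a)
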